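{- There exist a connected graph $G$ of order $n\geq 2$ and a graph $H$ with $k\geq 1$ connected components $H_1,\ldots,H_k$ such that $\chi_L(G\odot H)=l$ with $$\max\{\chi_L(H_t+K_1): 1\leq t\leq k\}< l< \chi_L(G)+\sum_{t=1}^{k}\bigl(\chi_L(H_t+K_1)-1\bigr).$$
   Context: All graphs are finite and simple. For a connected graph $G$, a $k$-coloring is a map $c:V(G)\to\{1,\ldots,k\}$ with $c(u)\neq c(v)$ whenever $uv\in E(G)$; it induces the partition $\Pi=\{C_1,\ldots,C_k\}$ into color classes. The color code of $v$ is $c_\Pi(v)=(d(v,C_1),\ldots,d(v,C_k))$, where $d(v,C_i)=\min\{d(v,x): x\in C_i\}$. The coloring is locating if distinct vertices have distinct color codes; $\chi_L(G)$ is the least $k$ admitting a locating $k$-coloring. The corona product $G\odot H$ (for $V(G)=\{a_1,\ldots,a_n\}$) is obtained from one copy of $G$ and $n$ copies of $H$ by joining $a_i$ to every vertex of the $i$-th copy of $H$. $H_t+K_1$ denotes the join of $H_t$ with a single new vertex adjacent to all vertices of $H_t$. -}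

module Defs where

open import Data.Nat using (ℕ; zero; suc; _≤_; _<_; _+_; _∸_)
open import Data.Fin using (Fin)
open import Data.List using (List; map; allFin)
open import Data.Nat.ListAction using (sum)
open import Data.Sum using (_⊎_; inj₁; inj₂)
open import Data.Maybe using (Maybe; just; nothing)
open import Data.Product using (Σ; _×_; _,_; ∃-syntax)
open import Data.Unit using (⊤)
open import Data.Empty using (⊥)
open import Relation.Nullary using (¬_)
open import Relation.Binary.PropositionalEquality using (_≡_; _≢_; subst)
open import Function.Bundles using (_⇔_)

record Graph (V : Set) : Set₁ where
  field
    _~_ : V → V → Set
open Graph public

IsSimple : {V : Set} → Graph V → Set
IsSimple {V} G = (∀ (u v : V) → _~_ G u v → _~_ G v u) × (∀ (v : V) → ¬ _~_ G v v)

data Walk {V : Set} (G : Graph V) : V → V → ℕ → Set where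
  here : ∀ {u} → Walk G u u zero
  step : ∀ {u w v m} → _~_ G u w → Walk G w v m → Walk G u v (suc m)

Connected : {V : Set} → Graph V → Set
Connected {V} G = V × (∀ (u v : V) → ∃[ m ] Walk G u v m)

DistToClass : {V : Set} {k : ℕ} → Graph V → (V → Fin k) → Fin k → V → ℕ → Set
DistToClass {V} G c i u d =
  (∃[ x ] (c x ≡ i × Walk G u x d)) × (∀ (x : V) (m : ℕ) → c x ≡ i → Walk G u x m → d ≤ m)

ProperColoring : {V : Set} {k : ℕ} → Graph V → (V → Fin k) → Set
ProperColoring {V} G c = ∀ (u v : V) → _~_ G u v → c u ≢ c v

-- u and v have the same color code: for every class, the same distance
-- (an empty class gives distance ∞ = no finite d, for both).
SameCode : {V : Set} {k : ℕ} → Graph V → (V → Fin k) → V → V → Set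
SameCode G c u v = ∀ i d → DistToClass G c i u d ⇔ DistToClass G c i v d

LocatingColoring : {V : Set} {k : ℕ} → Graph V → (V → Fin k) → Set
LocatingColoring {V} G c = ProperColoring G c × (∀ (u v : V) → u ≢ v → ¬ SameCode G c u v)

-- χ_L(G) = l  (colors are Fin l instead of {1..l})
IsLocChromNum : {V : Set} → Graph V → ℕ → Set
IsLocChromNum {V} G l =
  (∃[ c ] LocatingColoring {V} {l} G c)
  × (∀ (k : ℕ) → k < l → (c : V → Fin k) → ¬ LocatingColoring G c)

-- Corona product G ⊙ H: vertices inj₁ a (copy of G) and inj₂ (a , w)
-- (vertex w of the copy of H attached to a).
corona : {V W : Set} → Graph V → Graph W → Graph (V ⊎ (V × W))
_~_ (corona G H) (inj₁ a) (inj₁ b) = _~_ G a b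
_~_ (corona G H) (inj₁ a) (inj₂ (b , w)) = a ≡ b
_~_ (corona G H) (inj₂ (a , w)) (inj₁ b) = a ≡ b
_~_ (corona G H) (inj₂ (a , w)) (inj₂ (b , w')) = (a ≡ b) × _~_ H w w'

-- H + K₁: the new vertex is nothing.
coneK1 : {W : Set} → Graph W → Graph (Maybe W)
_~_ (coneK1 H) nothing nothing = ⊥
_~_ (coneK1 H) nothing (just w) = ⊤
_~_ (coneK1 H) (just w) nothing = ⊤
_~_ (coneK1 H) (just w) (just w') = _~_ H w w'

disjUnion : {k : ℕ} {W : Fin k → Set} → ((t : Fin k) → Graph (W t)) → Graph (Σ (Fin k) W)
_~_ (disjUnion {W = W} Hs) (t , x) (s , y) = Σ (t ≡ s) (λ e → _~_ (Hs s) (subst W e x) y)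

sumFin : (k : ℕ) → (Fin k → ℕ) → ℕ
sumFin k f = sum (map f (allFin k))

-- The witness is G = K₂ and H = K₁ ∪ K₁, so that G ⊙ H is the edge a₁a₂ with two pendant
-- vertices at each end.  Here χ_L(G) = 2 and χ_L(K₁ + K₁) = χ_L(K₂) = 2, so the bounds are
-- 2 < l < 2 + 1 + 1, and l = 3: a 3-colouring is located by which classes lie at distance 1,
-- while in any 2-colouring the two pendants at a₁ share a colour and are swapped by an
-- automorphism that preserves it, hence have the same colour code.
module Submission where

open import Defs
open import Data.Nat using (ℕ; _≤_; _<_; _+_; _∸_; zero; suc; z≤n; s≤s; s≤s⁻¹)
open import Data.Nat.Properties using (<⇒≱; ≤-antisym)
open import Data.Fin using (Fin; zero; suc; _≟_; opposite)
open import Data.Fin.Properties using (opposite-involutive)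
open import Data.Product using (Σ; _×_; ∃-syntax; _,_)
open import Data.Sum using (_⊎_; inj₁; inj₂)
open import Data.Maybe using (Maybe; just; nothing)
open import Data.Unit using (tt)
open import Data.Empty using (⊥-elim)
open import Function using (_∘_; id)
open import Function.Bundles using (Equivalence; mk⇔)
open import Function.Definitions using (Injective)
import Function.Properties.Equivalence as ⇔
open import Relation.Nullary using (¬_; yes; no; contraposition)
open import Relation.Binary.PropositionalEquality
  using (_≡_; _≢_; refl; sym; trans; subst; cong; ≢-sym)

module ColourCodes {V : Set} {k : ℕ} (G : Graph V) (c : V → Fin k) where

  distToOwnClass : ∀ u → DistToClass G c (c u) u 0
  distToOwnClass u = (u , refl , here) , λ _ _ _ _ → z≤n

  distToClass-neighbour : ∀ {i u x} → c u ≢ i → c x ≡ i → _~_ G u x → DistToClass G c i u 1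
  distToClass-neighbour {i} {x = x} cu≢i cx≡i u~x = (x , cx≡i , step u~x here) , atLeast1
    where
    atLeast1 : ∀ y m → c y ≡ i → Walk G _ y m → 1 ≤ m
    atLeast1 _ zero cy≡i here = ⊥-elim (cu≢i cy≡i)
    atLeast1 _ (suc _) _ _ = s≤s z≤n

  sameCode-sym : ∀ {u v} → SameCode G c u v → SameCode G c v u
  sameCode-sym same i d = ⇔.sym (same i d)

  sameCode⇒sameColour : ∀ {u v} → SameCode G c u v → c u ≡ c v
  sameCode⇒sameColour {u} same with Equivalence.to (same (c u) 0) (distToOwnClass u)
  ... | (_ , cx≡cu , here) , _ = sym cx≡cu

  differentColour⇒differentCode : ∀ {u v} → c u ≢ c v → ¬ SameCode G c u v
  differentColour⇒differentCode = contraposition sameCode⇒sameColour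

  nearClass⇒differentCode : ∀ {i u v} → DistToClass G c i u 1 →
    (∀ x → c x ≡ i → ¬ Walk G v x 1) → ¬ SameCode G c u v
  nearClass⇒differentCode {i} near farFromV same with Equivalence.to (same i 1) near
  ... | (x , cx≡i , walk) , _ = farFromV x cx≡i walk

  injective⇒locating : ProperColoring G c → Injective _≡_ _≡_ c → LocatingColoring G c
  injective⇒locating proper inj = proper , λ u v u≢v → differentColour⇒differentCode (u≢v ∘ inj)

Fin1-unique : (x y : Fin 1) → x ≡ y
Fin1-unique zero zero = refl

Fin2-≢-≢⇒≡ : {x y z : Fin 2} → x ≢ z → y ≢ z → x ≡ y
Fin2-≢-≢⇒≡ {zero}     {zero}     _ _ = refl
Fin2-≢-≢⇒≡ {suc zero} {suc zero} _ _ = refl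
Fin2-≢-≢⇒≡ {zero}     {suc zero} {zero}     x≢z _ = ⊥-elim (x≢z refl)
Fin2-≢-≢⇒≡ {zero}     {suc zero} {suc zero} _ y≢z = ⊥-elim (y≢z refl)
Fin2-≢-≢⇒≡ {suc zero} {zero}     {zero}     _ y≢z = ⊥-elim (y≢z refl)
Fin2-≢-≢⇒≡ {suc zero} {zero}     {suc zero} x≢z _ = ⊥-elim (x≢z refl)

module _ {V : Set} (G : Graph V) where

  edge⇒2≤colours : ∀ {k u v} {c : V → Fin k} → _~_ G u v → ProperColoring G c → 2 ≤ k
  edge⇒2≤colours {zero}        {u} {c = c} _ _ with c u
  ... | ()
  edge⇒2≤colours {suc zero}    {u} {v} {c} u~v proper = ⊥-elim (proper u v u~v (Fin1-unique (c u) (c v)))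
  edge⇒2≤colours {suc (suc k)} _ _ = s≤s (s≤s z≤n)

  injective⇒locChromNum2 : ∀ {u v} → _~_ G u v → (c : V → Fin 2) →
    ProperColoring G c → Injective _≡_ _≡_ c → IsLocChromNum G 2
  injective⇒locChromNum2 u~v c proper inj =
    (c , ColourCodes.injective⇒locating G c proper inj) ,
    λ k k<2 c′ (proper′ , _) → <⇒≱ k<2 (edge⇒2≤colours u~v proper′)

  commonNeighbour⇒sameColour : ∀ {w u v} {c : V → Fin 2} → ProperColoring G c →
    _~_ G w u → _~_ G w v → c u ≡ c v
  commonNeighbour⇒sameColour {w} {u} {v} proper w~u w~v =
    Fin2-≢-≢⇒≡ (≢-sym (proper w u w~u)) (≢-sym (proper w v w~v))

module Automorphism {V : Set} {k : ℕ} (G : Graph V) (c : V → Fin k) (σ : V → V)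
  (σ-adj : ∀ {u v} → _~_ G u v → _~_ G (σ u) (σ v))
  (σ-involutive : ∀ u → σ (σ u) ≡ u)
  (σ-colour : ∀ u → c (σ u) ≡ c u) where

  walk-map : ∀ {u x m} → Walk G u x m → Walk G (σ u) (σ x) m
  walk-map here = here
  walk-map (step u~w walk) = step (σ-adj u~w) (walk-map walk)

  distToClass-map : ∀ {i u d} → DistToClass G c i u d → DistToClass G c i (σ u) d
  distToClass-map {i} {u} {d} ((x , cx≡i , walk) , minimal) =
    (σ x , trans (σ-colour x) cx≡i , walk-map walk) ,
    λ y m cy≡i walk′ → minimal (σ y) m (trans (σ-colour y) cy≡i)
      (subst (λ z → Walk G z (σ y) m) (σ-involutive u) (walk-map walk′))

  sameCode-image : ∀ u → SameCode G c u (σ u)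
  sameCode-image u i d = mk⇔ distToClass-map
    (subst (λ z → DistToClass G c i z d) (σ-involutive u) ∘ distToClass-map)

complete : (n : ℕ) → Graph (Fin n)
complete n = record { _~_ = _≢_ }

complete-simple : ∀ n → IsSimple (complete n)
complete-simple _ = (λ _ _ → ≢-sym) , λ _ v≢v → v≢v refl

complete-connected : ∀ n → Connected (complete (suc n))
complete-connected n = zero , walk
  where
  walk : ∀ u v → ∃[ m ] Walk (complete (suc n)) u v m
  walk u v with u ≟ v
  ... | yes refl = 0 , here
  ... | no u≢v = 1 , step u≢v here

Edgeless : {V : Set} → Graph V → Set
Edgeless {V} G = ∀ (u v : V) → ¬ _~_ G u v

complete1-edgeless : Edgeless (complete 1)
complete1-edgeless u v u≢v = u≢v (Fin1-unique u v)

disjUnion-edgeless : ∀ {k} {W : Fin k → Set} {Hs : (t : Fin k) → Graph (W t)} →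
  (∀ t → Edgeless (Hs t)) → Edgeless (disjUnion Hs)
disjUnion-edgeless {W = W} edgeless (t , x) (s , y) (t≡s , x~y) = edgeless s (subst W t≡s x) y x~y

corona-pendant-neighbour : ∀ {V W} {G : Graph V} {H : Graph W} → Edgeless H →
  ∀ {a w x} → _~_ (corona G H) (inj₂ (a , w)) x → x ≡ inj₁ a
corona-pendant-neighbour _ {x = inj₁ b} a≡b = cong inj₁ (sym a≡b)
corona-pendant-neighbour edgeless {w = w} {x = inj₂ (b , w′)} (_ , w~w′) = ⊥-elim (edgeless w w′ w~w′)

pendant-farFromClass : ∀ {V W k} {G : Graph V} {H : Graph W} → Edgeless H →
  (c : V ⊎ (V × W) → Fin k) → ∀ {a w i} → c (inj₁ a) ≢ i →
  ∀ x → c x ≡ i → ¬ Walk (corona G H) (inj₂ (a , w)) x 1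
pendant-farFromClass {G = G} edgeless c {a} {w} {i} hub≢i x cx≡i (step p~x here) =
  hub≢i (subst (λ y → c y ≡ i) (corona-pendant-neighbour {G = G} edgeless {a} {w} {x} p~x) cx≡i)

apexColouring : Maybe (Fin 1) → Fin 2
apexColouring nothing = zero
apexColouring (just _) = suc zero

K₁+K₁-locChromNum : IsLocChromNum (coneK1 (complete 1)) 2
K₁+K₁-locChromNum = injective⇒locChromNum2 (coneK1 (complete 1)) {nothing} {just zero} tt
  apexColouring proper injective
  where
  proper : ProperColoring (coneK1 (complete 1)) apexColouring
  proper (just u) (just v) u~v _ = complete1-edgeless u v u~v
  proper nothing (just _) _ ()
  proper (just _) nothing _ ()

  injective : Injective _≡_ _≡_ apexColouring
  injective {nothing} {nothing} _ = refl
  injective {just u} {just v} _ = cong just (Fin1-unique u v)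

K₂-locChromNum : IsLocChromNum (complete 2) 2
K₂-locChromNum = injective⇒locChromNum2 (complete 2) {zero} {suc zero} (λ ()) id proper id
  where
  proper : ProperColoring (complete 2) id
  proper u v u≢v = u≢v

Pendants : Graph (Σ (Fin 2) (λ _ → Fin 1))
Pendants = disjUnion (λ _ → complete 1)

pendants-edgeless : Edgeless Pendants
pendants-edgeless = disjUnion-edgeless (λ _ → complete1-edgeless)

Vertex : Set
Vertex = Fin 2 ⊎ (Fin 2 × Σ (Fin 2) (λ _ → Fin 1))

Corona : Graph Vertex
Corona = corona (complete 2) Pendants

pattern a₁ = inj₁ zero
pattern a₂ = inj₁ (suc zero)
pattern x₁ = inj₂ (zero , zero , zero)
pattern x₂ = inj₂ (zero , suc zero , zero)
pattern y₁ = inj₂ (suc zero , zero , zero)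
pattern y₂ = inj₂ (suc zero , suc zero , zero)

colour : Vertex → Fin 3
colour a₁ = zero
colour a₂ = suc zero
colour x₁ = suc zero
colour x₂ = suc (suc zero)
colour y₁ = zero
colour y₂ = suc (suc zero)

colour-proper : ProperColoring Corona colour
colour-proper (inj₂ (_ , p)) (inj₂ (_ , q)) (_ , p~q) = ⊥-elim (pendants-edgeless p q p~q)
colour-proper a₁ a₁ a≢a = ⊥-elim (a≢a refl)
colour-proper a₂ a₂ a≢a = ⊥-elim (a≢a refl)
colour-proper a₁ a₂ _ ()
colour-proper a₂ a₁ _ ()
colour-proper a₁ x₁ refl ()
colour-proper a₁ x₂ refl ()
colour-proper a₂ y₁ refl ()
colour-proper a₂ y₂ refl ()
colour-proper x₁ a₁ refl ()
colour-proper x₂ a₁ refl ()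
colour-proper y₁ a₂ refl ()
colour-proper y₂ a₂ refl ()

open ColourCodes Corona colour

pendantFar : ∀ {a w i} → colour (inj₁ a) ≢ i → ∀ x → colour x ≡ i → ¬ Walk Corona (inj₂ (a , w)) x 1
pendantFar = pendant-farFromClass pendants-edgeless colour

a₁≉y₁ : ¬ SameCode Corona colour a₁ y₁
a₁≉y₁ = nearClass⇒differentCode (distToClass-neighbour {x = x₂} (λ ()) refl refl) (pendantFar (λ ()))

a₂≉x₁ : ¬ SameCode Corona colour a₂ x₁
a₂≉x₁ = nearClass⇒differentCode (distToClass-neighbour {x = y₂} (λ ()) refl refl) (pendantFar (λ ()))

x₂≉y₂ : ¬ SameCode Corona colour x₂ y₂
x₂≉y₂ = nearClass⇒differentCode (distToClass-neighbour {x = a₁} (λ ()) refl refl) (pendantFar (λ ()))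

colour-locating : ∀ u v → u ≢ v → ¬ SameCode Corona colour u v
colour-locating a₁ a₁ u≢v = ⊥-elim (u≢v refl)
colour-locating a₁ a₂ _ = differentColour⇒differentCode (λ ())
colour-locating a₁ x₁ _ = differentColour⇒differentCode (λ ())
colour-locating a₁ x₂ _ = differentColour⇒differentCode (λ ())
colour-locating a₁ y₁ _ = a₁≉y₁
colour-locating a₁ y₂ _ = differentColour⇒differentCode (λ ())
colour-locating a₂ a₁ _ = differentColour⇒differentCode (λ ())
colour-locating a₂ a₂ u≢v = ⊥-elim (u≢v refl)
colour-locating a₂ x₁ _ = a₂≉x₁
colour-locating a₂ x₂ _ = differentColour⇒differentCode (λ ())
colour-locating a₂ y₁ _ = differentColour⇒differentCode (λ ())
colour-locating a₂ y₂ _ = differentColour⇒differentCode (λ ())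
colour-locating x₁ a₁ _ = differentColour⇒differentCode (λ ())
colour-locating x₁ a₂ _ = a₂≉x₁ ∘ sameCode-sym
colour-locating x₁ x₁ u≢v = ⊥-elim (u≢v refl)
colour-locating x₁ x₂ _ = differentColour⇒differentCode (λ ())
colour-locating x₁ y₁ _ = differentColour⇒differentCode (λ ())
colour-locating x₁ y₂ _ = differentColour⇒differentCode (λ ())
colour-locating x₂ a₁ _ = differentColour⇒differentCode (λ ())
colour-locating x₂ a₂ _ = differentColour⇒differentCode (λ ())
colour-locating x₂ x₁ _ = differentColour⇒differentCode (λ ())
colour-locating x₂ x₂ u≢v = ⊥-elim (u≢v refl)
colour-locating x₂ y₁ _ = differentColour⇒differentCode (λ ())
colour-locating x₂ y₂ _ = x₂≉y₂
colour-locating y₁ a₁ _ = a₁≉y₁ ∘ sameCode-sym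
colour-locating y₁ a₂ _ = differentColour⇒differentCode (λ ())
colour-locating y₁ x₁ _ = differentColour⇒differentCode (λ ())
colour-locating y₁ x₂ _ = differentColour⇒differentCode (λ ())
colour-locating y₁ y₁ u≢v = ⊥-elim (u≢v refl)
colour-locating y₁ y₂ _ = differentColour⇒differentCode (λ ())
colour-locating y₂ a₁ _ = differentColour⇒differentCode (λ ())
colour-locating y₂ a₂ _ = differentColour⇒differentCode (λ ())
colour-locating y₂ x₁ _ = differentColour⇒differentCode (λ ())
colour-locating y₂ x₂ _ = x₂≉y₂ ∘ sameCode-sym
colour-locating y₂ y₁ _ = differentColour⇒differentCode (λ ())
colour-locating y₂ y₂ u≢v = ⊥-elim (u≢v refl)

swapPendants : Vertex → Vertex
swapPendants (inj₁ a) = inj₁ a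
swapPendants (inj₂ (zero , t , w)) = inj₂ (zero , opposite t , w)
swapPendants (inj₂ (suc zero , p)) = inj₂ (suc zero , p)

swapPendants-adj : ∀ {u v} → _~_ Corona u v → _~_ Corona (swapPendants u) (swapPendants v)
swapPendants-adj {inj₁ _} {inj₁ _} a~b = a~b
swapPendants-adj {inj₁ _} {inj₂ (zero , _)} a≡b = a≡b
swapPendants-adj {inj₁ _} {inj₂ (suc zero , _)} a≡b = a≡b
swapPendants-adj {inj₂ (zero , _)} {inj₁ _} a≡b = a≡b
swapPendants-adj {inj₂ (suc zero , _)} {inj₁ _} a≡b = a≡b
swapPendants-adj {inj₂ (_ , p)} {inj₂ (_ , q)} (_ , p~q) = ⊥-elim (pendants-edgeless p q p~q)

swapPendants-involutive : ∀ u → swapPendants (swapPendants u) ≡ u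
swapPendants-involutive (inj₁ _) = refl
swapPendants-involutive (inj₂ (zero , t , w)) = cong (λ s → inj₂ (zero , s , w)) (opposite-involutive t)
swapPendants-involutive (inj₂ (suc zero , _)) = refl

twins-sameCode : (c : Vertex → Fin 2) → ProperColoring Corona c → SameCode Corona c x₁ x₂
twins-sameCode c proper = Automorphism.sameCode-image Corona c swapPendants
  (λ {u} {v} → swapPendants-adj {u} {v}) swapPendants-involutive preserved x₁
  where
  x₁≡x₂ : c x₁ ≡ c x₂
  x₁≡x₂ = commonNeighbour⇒sameColour Corona {a₁} {x₁} {x₂} proper refl refl

  preserved : ∀ u → c (swapPendants u) ≡ c u
  preserved (inj₁ _) = refl
  preserved x₁ = sym x₁≡x₂
  preserved x₂ = x₁≡x₂
  preserved (inj₂ (suc zero , _)) = refl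

corona-locChromNum : IsLocChromNum Corona 3
corona-locChromNum = (colour , colour-proper , colour-locating) , noSmaller
  where
  noSmaller : ∀ k → k < 3 → (c : Vertex → Fin k) → ¬ LocatingColoring Corona c
  noSmaller k k<3 c (proper , locating)
    with ≤-antisym (s≤s⁻¹ k<3) (edge⇒2≤colours Corona {u = a₁} {x₁} refl proper)
  ... | refl = locating x₁ x₂ (λ ()) (twins-sameCode c proper)

theorem4 : ∃[ n ] (2 ≤ n × Σ (Graph (Fin n)) (λ G → IsSimple G × Connected G ×
             ∃[ k ] (1 ≤ k × Σ (Fin k → ℕ) (λ m → Σ ((t : Fin k) → Graph (Fin (m t))) (λ Hs →
               (∀ t → IsSimple (Hs t)) × (∀ t → Connected (Hs t)) ×
               ∃[ l ] (IsLocChromNum (corona G (disjUnion Hs)) l ×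
                 ∃[ a ] (IsLocChromNum G a ×
                   Σ (Fin k → ℕ) (λ b → (∀ t → IsLocChromNum (coneK1 (Hs t)) (b t)) ×
                     (∀ t → b t < l) ×
                     l < a + sumFin k (λ t → b t ∸ 1)))))))))
theorem4 =
  2 , s≤s (s≤s z≤n) , complete 2 , complete-simple 2 , complete-connected 1 ,
  2 , s≤s z≤n , (λ _ → 1) , (λ _ → complete 1) ,
  (λ _ → complete-simple 1) , (λ _ → complete-connected 0) ,
  3 , corona-locChromNum ,
  2 , K₂-locChromNum ,
  (λ _ → 2) , (λ _ → K₁+K₁-locChromNum) , (λ _ → s≤s (s≤s (s≤s z≤n))) , s≤s (s≤s (s≤s (s≤s z≤n)))
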